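{- Let $L\geq 2$ and $N\geq 1$ be integers. Let $\mathcal{A}_{L,1}$ be the set of integer partitions whose smallest part is $1$, all of whose parts are $\leq L+1$, and in which the part $L$ does not appear. Let $\mathcal{A}_{L,2}$ be the set of non-empty partitions all of whose parts lie in $\{2,3,\dots,L+1\}$. Then \[ |\{\pi\in\mathcal{A}_{L,1} : |\pi|=N\}| \;\geq\; |\{\pi\in\mathcal{A}_{L,2} : |\pi|=N\}|. \]
   Context: A partition $\pi$ is given in frequency notation $\pi=(1^{f_1},2^{f_2},\dots)$ with $f_i\in\mathbb{Z}_{\geq 0}$, finitely many nonzero; $f_i$ is the number of occurrences of the part $i$. The norm of $\pi$ is $|\pi|=\sum_i i f_i$. -}

module Defs where

open import Data.Nat using (ℕ; zero; suc; _+_; _*_; _≤_; _≡ᵇ_)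
open import Data.Bool using (Bool; true; false; _∧_; not)
open import Data.Vec using (Vec; []; _∷_)
open import Data.List using (List; []; _∷_; map; concatMap; upTo; length; filterᵇ)

-- A partition all of whose parts are ≤ m, in frequency notation:
-- the vector (f_1, f_2, ..., f_m), where f_i = number of occurrences of part i.
-- (Partitions with all parts ≤ m are in bijection with such vectors.)
FreqVec : ℕ → Set
FreqVec m = Vec ℕ m

normFrom : ∀ {m} → ℕ → FreqVec m → ℕ
normFrom k [] = 0
normFrom k (f ∷ fs) = k * f + normFrom (suc k) fs

norm : ∀ {m} → FreqVec m → ℕ
norm = normFrom 1

allVecs : (m B : ℕ) → List (FreqVec m)
allVecs zero B = [] ∷ []
allVecs (suc m) B = concatMap (λ f → map (f ∷_) (allVecs m B)) (upTo (suc B))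

-- frequency of part i (1-indexed); 0 if i is out of range
freq : ∀ {m} → FreqVec m → ℕ → ℕ
freq [] i = 0
freq (f ∷ fs) zero = 0
freq (f ∷ fs) (suc zero) = f
freq (f ∷ fs) (suc (suc i)) = freq fs (suc i)

isZero : ℕ → Bool
isZero n = n ≡ᵇ 0

-- all parts of a frequency vector are in {1,...,m} by construction, so
-- A_{L,1} (parts ≤ L+1): smallest part is 1 (f_1 ≥ 1), and f_L = 0.
inA1 : (L : ℕ) → FreqVec (suc L) → Bool
inA1 L v = not (isZero (freq v 1)) ∧ isZero (freq v L)

nonEmpty : ∀ {m} → FreqVec m → Bool
nonEmpty [] = false
nonEmpty (f ∷ fs) = not (isZero f) Data.Bool.∨ nonEmpty fs

inA2 : (L : ℕ) → FreqVec (suc L) → Bool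
inA2 L v = isZero (freq v 1) ∧ nonEmpty v

-- number of partitions with parts ≤ L+1, norm N, satisfying predicate P.
-- Every such partition has all frequencies ≤ N, so allVecs (L+1) N enumerates them
-- (each exactly once).
count : (L N : ℕ) → (FreqVec (suc L) → Bool) → ℕ
count L N P = length (filterᵇ (λ v → P v ∧ (norm v ≡ᵇ N)) (allVecs (suc L) N))

module Submission where

-- We build a norm-preserving map
-- toA1 from A_{L,2} to A_{L,1} with a left inverse fromA1:
--   * if the part L occurs t + 1 times, replace these parts by (t + 1)·L ones;
--   * otherwise let s ≥ 2 be the smallest part, and replace one copy of s by
--     s ones.
-- The image has f₁ ≥ 1 and f_L = 0, and f₁ remembers the case: it is a
-- multiple of L in the first case but not in the second (s ∈ {2,…,L+1},
-- s ≠ L), which is what fromA1 uses to undo the map.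

open import Defs
open import Data.Nat using (ℕ; zero; suc; _+_; _*_; _∸_; _≤_; _<_; _≡ᵇ_; z≤n; s≤s; s≤s⁻¹; pred; _%_; _/_)
open import Data.Nat.Properties
open import Data.Nat.DivMod using (m<n⇒m%n≡m; [m+n]%n≡m%n; m*n%n≡0; m*n/n≡m)
open import Data.Bool using (Bool; T; _∧_)
open import Data.Bool.Properties using (T-∧)
open import Data.Unit using (tt)
open import Data.Vec using (Vec; []; _∷_)
open import Data.Vec.Properties using (∷-injective)
open import Data.List using (List; []; _∷_; map; length; filterᵇ; upTo; concatMap; cartesianProductWith; _++_)
open import Data.List.Properties using (length-map; length-++; map-∘; map-id-local)
open import Data.List.Relation.Unary.All as All using (All)
open import Data.List.Relation.Unary.Any using (here; there)
open import Data.List.Relation.Unary.Unique.Propositional using (Unique; []; _∷_)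
import Data.List.Relation.Unary.Unique.Propositional.Properties as Unique
open import Data.List.Membership.Propositional using (_∈_)
open import Data.List.Membership.Propositional.Properties
open import Data.Product using (∃; _×_; _,_; proj₁; proj₂)
open import Data.Sum using (inj₁; inj₂)
open import Function using (_∘_; Equivalence)
open import Relation.Binary using (tri<; tri≈; tri>)
open import Relation.Binary.PropositionalEquality
open import Relation.Nullary.Decidable using (T?)
open import Data.Empty using (⊥-elim)

open Equivalence using (to; from)
open ≡-Reasoning

-- Reading and overwriting the entry at a 0-based position of a vector
-- (out-of-range positions read as 0 and are left untouched).  Positions are
-- natural numbers because they are computed from part sizes, as in freq.
get : ∀ {m} → ℕ → Vec ℕ m → ℕ
get p       []       = 0
get zero    (f ∷ fs) = f
get (suc p) (f ∷ fs) = get p fs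

set : ∀ {m} → ℕ → ℕ → Vec ℕ m → Vec ℕ m
set p       x []       = []
set zero    x (f ∷ fs) = x ∷ fs
set (suc p) x (f ∷ fs) = f ∷ set p x fs

get-set : ∀ {m} p x (v : Vec ℕ m) → p < m → get p (set p x v) ≡ x
get-set zero    x (f ∷ v) _        = refl
get-set (suc p) x (f ∷ v) (s≤s lt) = get-set p x v lt

get-set-other : ∀ {m} p q x (v : Vec ℕ m) → p ≢ q → get q (set p x v) ≡ get q v
get-set-other p       q       x []      ne = refl
get-set-other zero    zero    x (f ∷ v) ne = ⊥-elim (ne refl)
get-set-other zero    (suc q) x (f ∷ v) ne = refl
get-set-other (suc p) zero    x (f ∷ v) ne = refl
get-set-other (suc p) (suc q) x (f ∷ v) ne = get-set-other p q x v (ne ∘ cong suc)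

set-set : ∀ {m} p x y (v : Vec ℕ m) → set p x (set p y v) ≡ set p x v
set-set p       x y []      = refl
set-set zero    x y (f ∷ v) = refl
set-set (suc p) x y (f ∷ v) = cong (f ∷_) (set-set p x y v)

set-get : ∀ {m} p (v : Vec ℕ m) → set p (get p v) v ≡ v
set-get p       []      = refl
set-get zero    (f ∷ v) = refl
set-get (suc p) (f ∷ v) = cong (f ∷_) (set-get p v)

positions-differ : ∀ {m} {p q u} (v : Vec ℕ m) → get p v ≡ suc u → get q v ≡ 0 → p ≢ q
positions-differ v gp gq refl = 0≢1+n (trans (sym gq) gp)

freq-get : ∀ {m} p (v : Vec ℕ m) → freq v (suc p) ≡ get p v
freq-get p       []      = refl
freq-get zero    (f ∷ v) = refl
freq-get (suc p) (f ∷ v) = freq-get p v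

norm-set : ∀ {m} j p x (v : Vec ℕ m) → p < m →
  normFrom j (set p x v) + (j + p) * get p v ≡ normFrom j v + (j + p) * x
norm-set j zero x (f ∷ v) _ rewrite +-identityʳ j = begin
  j * x + normFrom (suc j) v + j * f   ≡⟨ +-assoc (j * x) _ _ ⟩
  j * x + (normFrom (suc j) v + j * f) ≡⟨ +-comm (j * x) _ ⟩
  normFrom (suc j) v + j * f + j * x   ≡⟨ cong (_+ j * x) (+-comm _ (j * f)) ⟩
  j * f + normFrom (suc j) v + j * x   ∎
norm-set j (suc p) x (f ∷ v) (s≤s lt) rewrite +-suc j p = begin
  j * f + normFrom (suc j) (set p x v) + suc (j + p) * get p v   ≡⟨ +-assoc (j * f) _ _ ⟩
  j * f + (normFrom (suc j) (set p x v) + suc (j + p) * get p v) ≡⟨ cong (j * f +_) (norm-set (suc j) p x v lt) ⟩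
  j * f + (normFrom (suc j) v + suc (j + p) * x)                 ≡⟨ +-assoc (j * f) _ _ ⟨
  j * f + normFrom (suc j) v + suc (j + p) * x                   ∎

norm-∷ : ∀ {m} c (rest : Vec ℕ m) → norm (c ∷ rest) ≡ c + normFrom 2 rest
norm-∷ c rest = cong (_+ normFrom 2 rest) (*-identityˡ c)

-- The position of the first nonzero entry; for rest = (f₂, …, f_{L+1}) the
-- smallest part is then firstNonzero rest + 2.
firstNonzero : ∀ {m} → Vec ℕ m → ℕ
firstNonzero []          = 0
firstNonzero (zero  ∷ v) = suc (firstNonzero v)
firstNonzero (suc _ ∷ v) = 0

firstNonzero-spec : ∀ {m} (v : Vec ℕ m) → T (nonEmpty v) →
  firstNonzero v < m × ∃ λ u → get (firstNonzero v) v ≡ suc u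
firstNonzero-spec (zero ∷ v) ne with firstNonzero-spec v ne
... | lt , u , eq = s≤s lt , u , eq
firstNonzero-spec (suc f ∷ v) ne = s≤s z≤n , f , refl

-- The part p + 2 with p < L, p + 2 ≠ L, is not a multiple of L = k + 2;
-- this lets fromA1 tell the two cases of toA1 apart.
part-not-multiple : ∀ k p → p < 2 + k → p ≢ k → ∃ λ r → (2 + p) % (2 + k) ≡ suc r
part-not-multiple k p lt ne with <-cmp p k
... | tri< p<k _ _ = suc p , m<n⇒m%n≡m (s≤s (s≤s p<k))
... | tri≈ _ p≡k _ = ⊥-elim (ne p≡k)
... | tri> _ _ p>k with ≤-antisym (s≤s⁻¹ lt) p>k
... | refl = 0 , trans ([m+n]%n≡m%n 1 (2 + k)) (m<n⇒m%n≡m {2 + k} {1} (s≤s (s≤s z≤n)))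

-- The map A_{L,2} → A_{L,1} for L = k + 2 (f₁ is ignored; it is 0 on A_{L,2}).
-- In rest, the part L sits at position k and the part s + 2 at position s.
toA1 : (k : ℕ) → FreqVec (3 + k) → FreqVec (3 + k)
toA1 k (c ∷ rest) with get k rest
... | suc t = suc t * (2 + k) ∷ set k 0 rest
... | zero  = 2 + firstNonzero rest ∷ set (firstNonzero rest) (pred (get (firstNonzero rest) rest)) rest

fromA1 : (k : ℕ) → FreqVec (3 + k) → FreqVec (3 + k)
fromA1 k (c ∷ rest) with c % (2 + k)
... | zero  = 0 ∷ set k (c / (2 + k)) rest
... | suc _ = 0 ∷ set (c ∸ 2) (suc (get (c ∸ 2) rest)) rest

fromA1-toA1 : ∀ k (v : FreqVec (3 + k)) → T (inA2 (2 + k) v) → fromA1 k (toA1 k v) ≡ v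
fromA1-toA1 k (zero ∷ rest) inA2 with get k rest in fL
... | suc t rewrite m*n%n≡0 (suc t) (2 + k) ⦃ _ ⦄ | m*n/n≡m (suc t) (2 + k) ⦃ _ ⦄ = cong (0 ∷_) (begin
  set k (suc t) (set k 0 rest) ≡⟨ set-set k (suc t) 0 rest ⟩
  set k (suc t) rest           ≡⟨ cong (λ x → set k x rest) fL ⟨
  set k (get k rest) rest      ≡⟨ set-get k rest ⟩
  rest                         ∎)
... | zero with firstNonzero rest | firstNonzero-spec rest inA2
... | s | s<L , u , fs with part-not-multiple k s s<L (positions-differ rest fs fL)
... | _ , rem rewrite fs | rem = cong (0 ∷_) (begin
  set s (suc (get s (set s u rest))) (set s u rest) ≡⟨ cong (λ x → set s (suc x) (set s u rest)) (get-set s u rest s<L) ⟩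
  set s (suc u) (set s u rest)                      ≡⟨ set-set s (suc u) u rest ⟩
  set s (suc u) rest                                ≡⟨ cong (λ x → set s x rest) fs ⟨
  set s (get s rest) rest                           ≡⟨ set-get s rest ⟩
  rest                                              ∎)

toA1-norm : ∀ k (v : FreqVec (3 + k)) → T (inA2 (2 + k) v) → norm (toA1 k v) ≡ norm v
toA1-norm k (zero ∷ rest) inA2 with get k rest in fL
... | suc t = begin
  norm (suc t * L ∷ set k 0 rest)           ≡⟨ norm-∷ (suc t * L) (set k 0 rest) ⟩
  suc t * L + normFrom 2 (set k 0 rest)     ≡⟨ +-comm (suc t * L) _ ⟩
  normFrom 2 (set k 0 rest) + suc t * L     ≡⟨ cong (λ x → normFrom 2 (set k 0 rest) + x * L) fL ⟨
  normFrom 2 (set k 0 rest) + get k rest * L ≡⟨ cong (normFrom 2 (set k 0 rest) +_) (*-comm (get k rest) L) ⟩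
  normFrom 2 (set k 0 rest) + L * get k rest ≡⟨ norm-set 2 k 0 rest (m≤n+m (suc k) 1) ⟩
  normFrom 2 rest + L * 0                   ≡⟨ cong (normFrom 2 rest +_) (*-zeroʳ L) ⟩
  normFrom 2 rest + 0                       ≡⟨ +-identityʳ _ ⟩
  normFrom 2 rest                           ∎
  where L = 2 + k
... | zero with firstNonzero rest | firstNonzero-spec rest inA2
... | s | s<L , u , fs rewrite fs = +-cancelʳ-≡ ((2 + s) * u) _ _ (begin
  norm (2 + s ∷ set s u rest) + (2 + s) * u         ≡⟨ cong (_+ (2 + s) * u) (norm-∷ (2 + s) (set s u rest)) ⟩
  2 + s + normFrom 2 (set s u rest) + (2 + s) * u   ≡⟨ cong (_+ (2 + s) * u) (+-comm (2 + s) _) ⟩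
  normFrom 2 (set s u rest) + (2 + s) + (2 + s) * u ≡⟨ +-assoc (normFrom 2 (set s u rest)) _ _ ⟩
  normFrom 2 (set s u rest) + ((2 + s) + (2 + s) * u) ≡⟨ cong (normFrom 2 (set s u rest) +_) (*-suc (2 + s) u) ⟨
  normFrom 2 (set s u rest) + (2 + s) * suc u       ≡⟨ cong (λ x → normFrom 2 (set s u rest) + (2 + s) * x) fs ⟨
  normFrom 2 (set s u rest) + (2 + s) * get s rest  ≡⟨ norm-set 2 s u rest s<L ⟩
  normFrom 2 rest + (2 + s) * u                     ∎)

isZero-≡0 : ∀ {x} → x ≡ 0 → T (isZero x)
isZero-≡0 refl = tt

toA1-inA1 : ∀ k (v : FreqVec (3 + k)) → T (inA2 (2 + k) v) → T (inA1 (2 + k) (toA1 k v))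
toA1-inA1 k (zero ∷ rest) inA2 with get k rest in fL
... | suc t = isZero-≡0 (trans (freq-get k (set k 0 rest)) (get-set k 0 rest (m≤n+m (suc k) 1)))
... | zero with firstNonzero-spec rest inA2
... | _ , _ , fs = isZero-≡0 (begin
  freq (set s x rest) (suc k) ≡⟨ freq-get k (set s x rest) ⟩
  get k (set s x rest)        ≡⟨ get-set-other s k x rest (positions-differ rest fs fL) ⟩
  get k rest                  ≡⟨ fL ⟩
  0                           ∎)
  where
  s = firstNonzero rest
  x = pred (get s rest)

unique-⊆-length : ∀ {A : Set} (xs ys : List A) → Unique xs → (∀ {x} → x ∈ xs → x ∈ ys) →
  length xs ≤ length ys
unique-⊆-length []       ys _          _   = z≤n
unique-⊆-length (x ∷ xs) ys (x∉xs ∷ u) xs⊆ys with ∈-∃++ (xs⊆ys (here refl))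
... | us , ws , refl = subst (suc (length xs) ≤_) (sym length-remove)
  (s≤s (unique-⊆-length xs (us ++ ws) u (λ z∈xs → remove z∈xs (xs⊆ys (there z∈xs)))))
  where
  length-remove : length (us ++ x ∷ ws) ≡ suc (length (us ++ ws))
  length-remove = trans (length-++ us) (trans (+-suc (length us) _) (cong suc (sym (length-++ us))))
  remove : ∀ {z} → z ∈ xs → z ∈ us ++ x ∷ ws → z ∈ us ++ ws
  remove z∈xs z∈ with ∈-++⁻ us z∈
  ... | inj₁ z∈us         = ∈-++⁺ˡ z∈us
  ... | inj₂ (here refl)  = ⊥-elim (All.lookup x∉xs z∈xs refl)
  ... | inj₂ (there z∈ws) = ∈-++⁺ʳ us z∈ws

unique-map : ∀ {A B : Set} (f : A → B) (f⁻ : B → A) {xs : List A} →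
  All (λ x → f⁻ (f x) ≡ x) xs → Unique xs → Unique (map f xs)
unique-map f f⁻ {xs} inv u = Unique.map⁻ (subst Unique (sym round-trip) u)
  where
  round-trip : map f⁻ (map f xs) ≡ xs
  round-trip = trans (sym (map-∘ xs)) (map-id-local inv)

injection-length : ∀ {A B : Set} (f : A → B) (f⁻ : B → A) (xs : List A) (ys : List B) →
  Unique xs → (∀ {x} → x ∈ xs → f⁻ (f x) ≡ x) → (∀ {x} → x ∈ xs → f x ∈ ys) →
  length xs ≤ length ys
injection-length f f⁻ xs ys u inv into =
  subst (_≤ length ys) (length-map f xs)
    (unique-⊆-length (map f xs) ys (unique-map f f⁻ (All.tabulate inv) u) image⊆ys)
  where
  image⊆ys : ∀ {y} → y ∈ map f xs → y ∈ ys
  image⊆ys y∈ with ∈-map⁻ f y∈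
  ... | x , x∈xs , refl = into x∈xs

concatMap-cartesian : ∀ {A B C : Set} (g : A → B → C) (xs : List A) (ys : List B) →
  concatMap (λ x → map (g x) ys) xs ≡ cartesianProductWith g xs ys
concatMap-cartesian g []       ys = refl
concatMap-cartesian g (x ∷ xs) ys = cong (map (g x) ys ++_) (concatMap-cartesian g xs ys)

allVecs-suc : ∀ m B → allVecs (suc m) B ≡ cartesianProductWith _∷_ (upTo (suc B)) (allVecs m B)
allVecs-suc m B = concatMap-cartesian _∷_ (upTo (suc B)) (allVecs m B)

allVecs-unique : ∀ m B → Unique (allVecs m B)
allVecs-unique zero    B = All.[] ∷ []
allVecs-unique (suc m) B rewrite allVecs-suc m B =
  Unique.cartesianProductWith⁺ _∷_ ∷-injective (Unique.upTo⁺ (suc B)) (allVecs-unique m B)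

allVecs-complete : ∀ {m} B j (v : Vec ℕ m) → normFrom (suc j) v ≤ B → v ∈ allVecs m B
allVecs-complete B j []      _ = here refl
allVecs-complete {suc m} B j (f ∷ v) norm≤B rewrite allVecs-suc m B =
  ∈-cartesianProductWith⁺ _∷_ (∈-upTo⁺ (s≤s f≤B)) (allVecs-complete B (suc j) v (≤-trans (m≤n+m _ _) norm≤B))
  where
  f≤B : f ≤ B
  f≤B = ≤-trans (≤-trans (m≤m+n f (j * f)) (m≤m+n _ _)) norm≤B

count-≤ : ∀ L N (P Q : FreqVec (suc L) → Bool) (f f⁻ : FreqVec (suc L) → FreqVec (suc L)) →
  (∀ v → T (P v) → T (Q (f v))) → (∀ v → T (P v) → norm (f v) ≡ norm v) →
  (∀ v → T (P v) → f⁻ (f v) ≡ v) → count L N P ≤ count L N Q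
count-≤ L N P Q f f⁻ PQ norm-f inv =
  injection-length f f⁻ xs ys (Unique.filter⁺ (T? ∘ withNorm P) (allVecs-unique _ N))
    (λ {v} v∈ → inv v (proj₁ (P-and-norm v∈))) into
  where
  withNorm : (FreqVec (suc L) → Bool) → FreqVec (suc L) → Bool
  withNorm R v = R v ∧ (norm v ≡ᵇ N)
  xs ys : List (FreqVec (suc L))
  xs = filterᵇ (withNorm P) (allVecs (suc L) N)
  ys = filterᵇ (withNorm Q) (allVecs (suc L) N)
  P-and-norm : ∀ {v} → v ∈ xs → T (P v) × norm v ≡ N
  P-and-norm v∈ with to T-∧ (proj₂ (∈-filter⁻ (T? ∘ withNorm P) {xs = allVecs (suc L) N} v∈))
  ... | Pv , nv = Pv , ≡ᵇ⇒≡ _ N nv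
  into : ∀ {v} → v ∈ xs → f v ∈ ys
  into {v} v∈ with P-and-norm v∈
  ... | Pv , nv = ∈-filter⁺ (T? ∘ withNorm Q) (allVecs-complete N 0 (f v) (≤-reflexive fv≡N))
    (from T-∧ (PQ v Pv , ≡⇒≡ᵇ _ N fv≡N))
    where
    fv≡N : norm (f v) ≡ N
    fv≡N = trans (norm-f v Pv) nv

theorem1p1 : (L N : ℕ) → 2 ≤ L → 1 ≤ N →
    count L N (inA2 L) ≤ count L N (inA1 L)
theorem1p1 (suc (suc k)) N (s≤s (s≤s z≤n)) _ =
  count-≤ (2 + k) N (inA2 (2 + k)) (inA1 (2 + k)) (toA1 k) (fromA1 k)
    (toA1-inA1 k) (toA1-norm k) (fromA1-toA1 k)
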